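{- Let $M,N\ge 0$ and let $W_{MN}$ be the poset of shuffles. Then every interval $[u,w]$ (with $u\le w$) of $W_{MN}$ is isomorphic to a product of posets of shuffles $W_{ij}$ (for suitable $i,j\ge 0$).
   Context: Let $\mathcal A=\{a_1,\dots,a_M\}$ (lower alphabet) and $\mathcal X=\{x_1,\dots,x_N\}$ (upper alphabet) be disjoint sets. A shuffle word is a (possibly empty) word with distinct letters from $\mathcal A\cup\mathcal X$ such that the letters from $\mathcal A$ occurring in it appear in increasing order of their subscripts, and likewise the letters from $\mathcal X$. The poset of shuffles $W_{MN}$ is the set of all shuffle words, ordered by the reflexive-transitive closure of the covering relation: $w\lessdot w'$ iff $w'$ is obtained from $w$ either by deleting one letter belonging to $\mathcal A$ or by inserting one letter belonging to $\mathcal X$ (so that the result is again a shuffle word). For general $i,j\ge0$, $W_{ij}$ denotes the poset of shuffles over alphabets of sizes $i$ and $j$. -}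

module Defs where

open import Data.Nat using (ℕ)
open import Data.Fin using (Fin) renaming (_<_ to _<ᶠ_)
open import Data.Sum using (_⊎_; inj₁; inj₂)
open import Data.Product using (Σ; _×_; _,_; proj₁)
open import Data.Unit using (⊤)
open import Data.List using (List; []; _∷_; _++_)
open import Data.List.Relation.Unary.AllPairs using (AllPairs)
open import Relation.Binary.PropositionalEquality using (_≡_; _≢_)
open import Relation.Binary.Construct.Closure.ReflexiveTransitive using (Star)

-- Letters: inj₁ a  is the lower letter a_{a+1} ∈ 𝒜 (|𝒜| = M),
--          inj₂ x  is the upper letter x_{x+1} ∈ 𝒳 (|𝒳| = N).
Letter : ℕ → ℕ → Set
Letter M N = Fin M ⊎ Fin N

lowers : ∀ {M N} → List (Letter M N) → List (Fin M)
lowers []           = []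
lowers (inj₁ a ∷ w) = a ∷ lowers w
lowers (inj₂ x ∷ w) = lowers w

uppers : ∀ {M N} → List (Letter M N) → List (Fin N)
uppers []           = []
uppers (inj₁ a ∷ w) = uppers w
uppers (inj₂ x ∷ w) = x ∷ uppers w

record IsShuffle {M N : ℕ} (w : List (Letter M N)) : Set where
  field
    distinct   : AllPairs _≢_ w
    lowers-inc : AllPairs _<ᶠ_ (lowers w)
    uppers-inc : AllPairs _<ᶠ_ (uppers w)

W : ℕ → ℕ → Set
W M N = Σ (List (Letter M N)) IsShuffle

word : ∀ {M N} → W M N → List (Letter M N)
word = proj₁

data _⋖_ {M N : ℕ} (v v' : W M N) : Set where
  delete : (p s : List (Letter M N)) (a : Fin M) →
           word v ≡ p ++ (inj₁ a ∷ s) → word v' ≡ p ++ s → v ⋖ v'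
  insert : (p s : List (Letter M N)) (x : Fin N) →
           word v ≡ p ++ s → word v' ≡ p ++ (inj₂ x ∷ s) → v ⋖ v'

_≤W_ : ∀ {M N} → W M N → W M N → Set
_≤W_ = Star _⋖_

_≈W_ : ∀ {M N} → W M N → W M N → Set
v ≈W v' = word v ≡ word v'

Interval : ∀ {M N} → W M N → W M N → Set
Interval {M} {N} u w = Σ (W M N) λ v → u ≤W v × v ≤W w

_≤I_ : ∀ {M N} {u w : W M N} → Interval u w → Interval u w → Set
(v , _) ≤I (v' , _) = v ≤W v'

_≈I_ : ∀ {M N} {u w : W M N} → Interval u w → Interval u w → Set
(v , _) ≈I (v' , _) = v ≈W v'

Prod : List (ℕ × ℕ) → Set
Prod []             = ⊤
Prod ((i , j) ∷ ds) = W i j × Prod ds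

_≤P_ : ∀ {ds} → Prod ds → Prod ds → Set
_≤P_ {[]}          _        _          = ⊤
_≤P_ {(i , j) ∷ ds} (x , xs) (y , ys) = (x ≤W y) × (xs ≤P ys)

_≈P_ : ∀ {ds} → Prod ds → Prod ds → Set
_≈P_ {[]}          _        _          = ⊤
_≈P_ {(i , j) ∷ ds} (x , xs) (y , ys) = (x ≈W y) × (xs ≈P ys)

record OrderIso {A B : Set} (_≈A_ _≤A_ : A → A → Set)
                (_≈B_ _≤B_ : B → B → Set) : Set where
  field
    to      : A → B
    from    : B → A
    to-mono   : ∀ {x y} → x ≤A y → to x ≤B to y
    from-mono : ∀ {x y} → x ≤B y → from x ≤A from y
    from∘to : ∀ x → from (to x) ≈A x
    to∘from : ∀ y → to (from y) ≈B y

{-# OPTIONS --safe #-}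
-- The order of W is the alignment order: v ≤ v' iff v' arises from v by deleting lower and
-- inserting upper letters, the remaining letters being matched in order.  An alignment of u
-- with w therefore keeps exactly the letters c₁, …, c_k common to u and w, and
-- u = A₀ c₁ A₁ ⋯ c_k A_k, w = X₀ c₁ X₁ ⋯ c_k X_k with lower words A_i and upper words X_i.
-- As letters are distinct, every v in [u, w] contains each c_i once and splits as
-- V₀ c₁ V₁ ⋯ c_k V_k with A_i ≤ V_i ≤ X_i, and v ≤ v' iff V_i ≤ V'_i for every i.
-- Renumbering the letters of A_i and X_i identifies the words between A_i and X_i with
-- W_{|A_i| |X_i|}, whence [u, w] ≅ ∏ᵢ W_{|A_i| |X_i|}.
module Submission where

open import Defs
open import Data.Nat using (ℕ)
open import Data.Product using (Σ; _×_)
open import Data.List using (List)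

open import Data.Empty using (⊥-elim)
open import Data.Unit using (tt)
open import Data.Fin using (Fin; zero; suc) renaming (_<_ to _<ᶠ_)
import Data.Fin.Properties as Finₚ
open import Data.Nat using (suc; s≤s; _≤_)
import Data.Nat.Properties as Natₚ
open import Data.Sum as Sum using (inj₁; inj₂; [_,_]′)
import Data.Sum.Properties as Sumₚ
open import Data.Product as Product using (∃; _,_; proj₁; proj₂)
open import Function using (_∘_)
open import Data.Maybe as Maybe using (Maybe; just; nothing)
open import Data.List using ([]; _∷_; _++_; map; mapMaybe; length; lookup)
open import Data.List.Properties using (mapMaybe-map-retract; ≡-dec)
open import Data.List.Relation.Unary.All as All using (All; []; _∷_)
open import Data.List.Relation.Unary.Any using (here; there)
open import Data.List.Relation.Unary.AllPairs as AllPairs using (AllPairs; []; _∷_; allPairs?)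
import Data.List.Relation.Unary.AllPairs.Properties as AllPairsₚ
import Data.List.Relation.Unary.All.Properties as Allₚ
open import Data.List.Relation.Unary.Unique.Propositional using (Unique)
open import Data.List.Membership.Propositional using (_∈_; _∉_)
open import Data.List.Membership.Propositional.Properties using (∈-insert; ∈-lookup; ∈-map⁺)
open import Data.List.Relation.Binary.Sublist.Propositional using (_⊆_; []; _∷_; _∷ʳ_; _⊇_; minimum; ⊆-refl)
open import Data.List.Relation.Binary.Sublist.Propositional.Properties using (All-resp-⊆; Any-resp-⊆; length-mono-≤; ++⁺ˡ; ++⁺ʳ)
open import Relation.Binary.Definitions using (_Respects_; DecidableEquality; tri<; tri≈; tri>)
open import Relation.Binary.Construct.Closure.ReflexiveTransitive using (Star; ε; _◅_; _◅◅_; gmap)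
open import Relation.Binary.Structures using (IsStrictTotalOrder)
open import Relation.Binary.PropositionalEquality hiding (J)
open import Relation.Nullary using (Dec; yes; no; ¬_)
open import Relation.Nullary.Decidable using (_×-dec_; recompute)

module _ {A : Set} where

  AllPairs-resp-⊆ : ∀ {R : A → A → Set} → (AllPairs R) Respects _⊇_
  AllPairs-resp-⊆ []         []         = []
  AllPairs-resp-⊆ (_ ∷ʳ σ)   (_ ∷ rys)  = AllPairs-resp-⊆ σ rys
  AllPairs-resp-⊆ (refl ∷ σ) (ry ∷ rys) = All-resp-⊆ σ ry ∷ AllPairs-resp-⊆ σ rys

  AllPairs-lookup : ∀ {R : A → A → Set} {xs} → AllPairs R xs →
                    ∀ {i j} → i <ᶠ j → R (lookup xs i) (lookup xs j)
  AllPairs-lookup (r ∷ _)  {zero}  {suc j} _         = All.lookup r (∈-lookup j)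
  AllPairs-lookup (_ ∷ rs) {suc i} {suc j} (s≤s i<j) = AllPairs-lookup rs i<j

  ∉-++-∷ˡ : ∀ (g : List A) {c r} → Unique (g ++ c ∷ r) → c ∉ g
  ∉-++-∷ˡ (x ∷ g) (x≢ ∷ _) (here refl) = All.lookup x≢ (∈-insert g) refl
  ∉-++-∷ˡ (x ∷ g) (_ ∷ u)  (there c∈g) = ∉-++-∷ˡ g u c∈g

module _ {A B : Set} {f : A → Maybe B} {g : B → A} where

  map-mapMaybe-inverse : ∀ {xs} → All (λ x → Maybe.map g (f x) ≡ just x) xs → map g (mapMaybe f xs) ≡ xs
  map-mapMaybe-inverse {[]}     []       = refl
  map-mapMaybe-inverse {x ∷ xs} (gfx ∷ ps) with f x | gfx
  ... | just y | refl = cong (g y ∷_) (map-mapMaybe-inverse ps)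

module _ {A : Set} {_<_ : A → A → Set} (sto : IsStrictTotalOrder _≡_ _<_) where
  open IsStrictTotalOrder sto using (compare; irrefl; asym)

  private
    ∈-tail : ∀ {y : A} {ys zs} → All (λ z → z ≢ y) zs → All (_∈ y ∷ ys) zs → All (_∈ ys) zs
    ∈-tail []          []                = []
    ∈-tail (z≢y ∷ ≢s) (here z≡y ∷ ∈s)  = ⊥-elim (z≢y z≡y)
    ∈-tail (_ ∷ ≢s)   (there z∈ ∷ ∈s)  = z∈ ∷ ∈-tail ≢s ∈s

  sorted-⊆ : ∀ {xs ys} → AllPairs _<_ xs → AllPairs _<_ ys → All (_∈ ys) xs → xs ⊆ ys
  sorted-⊆ {[]} _ _ _ = minimum _
  sorted-⊆ {x ∷ xs} {y ∷ ys} (x<xs ∷ sxs) (y<ys ∷ sys) (x∈ ∷ xs∈) with compare x y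
  ... | tri< _ x≢y y≮x with x∈
  ...   | here x≡y   = ⊥-elim (x≢y x≡y)
  ...   | there x∈ys = ⊥-elim (y≮x (All.lookup y<ys x∈ys))
  sorted-⊆ {x ∷ xs} {y ∷ ys} (x<xs ∷ sxs) (y<ys ∷ sys) (x∈ ∷ xs∈) | tri≈ _ refl _ =
    refl ∷ sorted-⊆ sxs sys (∈-tail (All.map (λ { x<z refl → irrefl refl x<z }) x<xs) xs∈)
  sorted-⊆ {x ∷ xs} {y ∷ ys} (x<xs ∷ sxs) (y<ys ∷ sys) (x∈ ∷ xs∈) | tri> x≮y x≢y _ =
    y ∷ʳ sorted-⊆ (x<xs ∷ sxs) sys (∈-tail (x≢y ∷ All.map (λ { x<z refl → x≮y x<z }) x<xs) (x∈ ∷ xs∈))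

  lookup-<⁻ : ∀ {xs} → AllPairs _<_ xs → ∀ {i j} → lookup xs i < lookup xs j → i <ᶠ j
  lookup-<⁻ sxs {i} {j} lt with Finₚ.<-cmp i j
  ... | tri< i<j _ _  = i<j
  ... | tri≈ _ refl _ = ⊥-elim (irrefl refl lt)
  ... | tri> _ _ j<i  = ⊥-elim (asym lt (AllPairs-lookup sxs j<i))

  map-lookup-sorted⁻ : ∀ {xs ks} → AllPairs _<_ xs → AllPairs _<_ (map (lookup xs) ks) → AllPairs _<ᶠ_ ks
  map-lookup-sorted⁻ sxs s = AllPairs.map (lookup-<⁻ sxs) (AllPairsₚ.map⁻ s)

  map-lookup-⊆ : ∀ {xs ks} → AllPairs _<_ xs → AllPairs _<ᶠ_ ks → map (lookup xs) ks ⊆ xs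
  map-lookup-⊆ {xs} {ks} sxs sks = sorted-⊆
    (AllPairsₚ.map⁺ (AllPairs.map (AllPairs-lookup sxs) sks)) sxs (Allₚ.map⁺ (All.universal ∈-lookup ks))

module _ {A : Set} (_≟_ : DecidableEquality A) where

  position : (xs : List A) → A → Maybe (Fin (length xs))
  position []       a = nothing
  position (b ∷ xs) a with a ≟ b
  ... | yes _ = just zero
  ... | no  _ = Maybe.map suc (position xs a)

  position-lookup : ∀ {xs} → Unique xs → ∀ k → position xs (lookup xs k) ≡ just k
  position-lookup {b ∷ xs} _ zero with b ≟ b
  ... | yes _   = refl
  ... | no  b≢b = ⊥-elim (b≢b refl)
  position-lookup {b ∷ xs} (b≢ ∷ u) (suc k) with lookup xs k ≟ b
  ... | yes eq = ⊥-elim (All.lookup b≢ (∈-lookup k) (sym eq))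
  ... | no  _  = cong (Maybe.map suc) (position-lookup u k)

  lookup-position : ∀ {xs a} → a ∈ xs → ∃ λ k → position xs a ≡ just k × lookup xs k ≡ a
  lookup-position {b ∷ xs} {a} a∈ with a ≟ b | a∈
  ... | yes a≡b | _         = zero , refl , sym a≡b
  ... | no  a≢b | here a≡b  = ⊥-elim (a≢b a≡b)
  ... | no  _   | there a∈xs with lookup-position a∈xs
  ...   | k , eq , look = suc k , cong (Maybe.map suc) eq , look

module BeforeAfter {A : Set} (_≟_ : DecidableEquality A) where

  before : A → List A → List A
  before c []      = []
  before c (l ∷ v) with l ≟ c
  ... | yes _ = []
  ... | no  _ = l ∷ before c v

  after : A → List A → List A
  after c []      = []
  after c (l ∷ v) with l ≟ c
  ... | yes _ = v
  ... | no  _ = after c v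

  before-∉ : ∀ c v → c ∉ before c v
  before-∉ c (l ∷ v) c∈ with l ≟ c | c∈
  ... | no l≢c | here c≡l = l≢c (sym c≡l)
  ... | no _   | there c∈′ = before-∉ c v c∈′

  after-∉ : ∀ {c} v → Unique v → c ∉ after c v
  after-∉ {c} (l ∷ v) (l≢ ∷ u) c∈ with l ≟ c
  ... | yes refl = All.lookup l≢ c∈ refl
  ... | no  _    = after-∉ v u c∈

  ∈⇒≡before++after : ∀ {c v} → c ∈ v → v ≡ before c v ++ c ∷ after c v
  ∈⇒≡before++after {c} {l ∷ v} c∈ with l ≟ c | c∈
  ... | yes refl | _         = refl
  ... | no  l≢c  | here c≡l  = ⊥-elim (l≢c (sym c≡l))
  ... | no  _    | there c∈′ = cong (l ∷_) (∈⇒≡before++after c∈′)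

  before-++-∷ : ∀ c (g : List A) {r} → c ∉ g → before c (g ++ c ∷ r) ≡ g
  before-++-∷ c []      _   with c ≟ c
  ... | yes _   = refl
  ... | no  c≢c = ⊥-elim (c≢c refl)
  before-++-∷ c (l ∷ g) c∉ with l ≟ c
  ... | yes l≡c = ⊥-elim (c∉ (here (sym l≡c)))
  ... | no  _   = cong (l ∷_) (before-++-∷ c g (c∉ ∘ there))

  after-++-∷ : ∀ c (g : List A) {r} → c ∉ g → after c (g ++ c ∷ r) ≡ r
  after-++-∷ c []      _   with c ≟ c
  ... | yes _   = refl
  ... | no  c≢c = ⊥-elim (c≢c refl)
  after-++-∷ c (l ∷ g) c∉ with l ≟ c
  ... | yes l≡c = ⊥-elim (c∉ (here (sym l≡c)))
  ... | no  _   = after-++-∷ c g (c∉ ∘ there)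

private
  variable
    M N I J : ℕ

_≟ˡ_ : DecidableEquality (Letter M N)
_≟ˡ_ = Sumₚ.≡-dec Finₚ._≟_ Finₚ._≟_

module _ {M N : ℕ} where
  open BeforeAfter (_≟ˡ_ {M} {N}) public

Sorted : List (Letter M N) → Set
Sorted v = AllPairs _<ᶠ_ (lowers v) × AllPairs _<ᶠ_ (uppers v)

lowers-map-inj₁ : (as : List (Fin M)) → lowers {M} {N} (map inj₁ as) ≡ as
lowers-map-inj₁ []       = refl
lowers-map-inj₁ (a ∷ as) = cong (a ∷_) (lowers-map-inj₁ as)

uppers-map-inj₂ : (xs : List (Fin N)) → uppers {M} {N} (map inj₂ xs) ≡ xs
uppers-map-inj₂ []       = refl
uppers-map-inj₂ (x ∷ xs) = cong (x ∷_) (uppers-map-inj₂ xs)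

lowers-map : (f : Fin M → Fin I) (g : Fin N → Fin J) (y : List (Letter M N)) →
             lowers (map (Sum.map f g) y) ≡ map f (lowers y)
lowers-map f g []           = refl
lowers-map f g (inj₁ a ∷ y) = cong (f a ∷_) (lowers-map f g y)
lowers-map f g (inj₂ x ∷ y) = lowers-map f g y

uppers-map : (f : Fin M → Fin I) (g : Fin N → Fin J) (y : List (Letter M N)) →
             uppers (map (Sum.map f g) y) ≡ map g (uppers y)
uppers-map f g []           = refl
uppers-map f g (inj₁ a ∷ y) = uppers-map f g y
uppers-map f g (inj₂ x ∷ y) = cong (g x ∷_) (uppers-map f g y)

lowers-⊆ : {v w : List (Letter M N)} → v ⊆ w → lowers v ⊆ lowers w
lowers-⊆ []                    = []
lowers-⊆ (inj₁ a ∷ʳ σ)         = a ∷ʳ lowers-⊆ σ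
lowers-⊆ (inj₂ x ∷ʳ σ)         = lowers-⊆ σ
lowers-⊆ (_∷_ {inj₁ a} refl σ) = refl ∷ lowers-⊆ σ
lowers-⊆ (_∷_ {inj₂ x} refl σ) = lowers-⊆ σ

uppers-⊆ : {v w : List (Letter M N)} → v ⊆ w → uppers v ⊆ uppers w
uppers-⊆ []                    = []
uppers-⊆ (inj₁ a ∷ʳ σ)         = uppers-⊆ σ
uppers-⊆ (inj₂ x ∷ʳ σ)         = x ∷ʳ uppers-⊆ σ
uppers-⊆ (_∷_ {inj₁ a} refl σ) = uppers-⊆ σ
uppers-⊆ (_∷_ {inj₂ x} refl σ) = refl ∷ uppers-⊆ σ

sorted⇒unique : (v : List (Letter M N)) → Sorted v → Unique v
sorted⇒unique []           _               = []
sorted⇒unique (inj₁ a ∷ v) (a<v ∷ sl , su) = fresh v a<v ∷ sorted⇒unique v (sl , su)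
  where
  fresh : ∀ v → All (a <ᶠ_) (lowers v) → All (inj₁ a ≢_) v
  fresh []           _           = []
  fresh (inj₁ b ∷ v) (a<b ∷ a<v) = (λ { refl → Finₚ.<-irrefl refl a<b }) ∷ fresh v a<v
  fresh (inj₂ y ∷ v) a<v         = (λ ()) ∷ fresh v a<v
sorted⇒unique (inj₂ x ∷ v) (sl , x<v ∷ su) = fresh v x<v ∷ sorted⇒unique v (sl , su)
  where
  fresh : ∀ v → All (x <ᶠ_) (uppers v) → All (inj₂ x ≢_) v
  fresh []           _           = []
  fresh (inj₁ b ∷ v) x<v         = (λ ()) ∷ fresh v x<v
  fresh (inj₂ y ∷ v) (x<y ∷ x<v) = (λ { refl → Finₚ.<-irrefl refl x<y }) ∷ fresh v x<v

sorted⇒isShuffle : {v : List (Letter M N)} → Sorted v → IsShuffle v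
sorted⇒isShuffle {v = v} s = record
  { distinct = sorted⇒unique v s ; lowers-inc = proj₁ s ; uppers-inc = proj₂ s }

isShuffle⇒sorted : {v : List (Letter M N)} → IsShuffle v → Sorted v
isShuffle⇒sorted s = IsShuffle.lowers-inc s , IsShuffle.uppers-inc s

isShuffle-resp-⊆ : {v w : List (Letter M N)} → v ⊆ w → IsShuffle w → IsShuffle v
isShuffle-resp-⊆ σ s = sorted⇒isShuffle
  ( AllPairs-resp-⊆ (lowers-⊆ σ) (IsShuffle.lowers-inc s)
  , AllPairs-resp-⊆ (uppers-⊆ σ) (IsShuffle.uppers-inc s))

prefix-isShuffle : ∀ (p : List (Letter M N)) {q} → IsShuffle (p ++ q) → IsShuffle p
prefix-isShuffle p = isShuffle-resp-⊆ (++⁺ʳ _ ⊆-refl)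

suffix-isShuffle : ∀ (p : List (Letter M N)) {q} → IsShuffle (p ++ q) → IsShuffle q
suffix-isShuffle p = isShuffle-resp-⊆ (++⁺ˡ p ⊆-refl)

sorted? : (v : List (Letter M N)) → Dec (Sorted v)
sorted? v = allPairs? Finₚ._<?_ (lowers v) ×-dec allPairs? Finₚ._<?_ (uppers v)

-- The irrelevant proof is turned back into a relevant one by deciding sortedness.
mkW : (v : List (Letter M N)) → .(IsShuffle v) → W M N
mkW v s = v , sorted⇒isShuffle (recompute (sorted? v) (isShuffle⇒sorted s))

infix 4 _⊑_

data _⊑_ {M N : ℕ} : List (Letter M N) → List (Letter M N) → Set where
  []   : [] ⊑ []
  keep : ∀ l {s t} → s ⊑ t → l ∷ s ⊑ l ∷ t
  del  : ∀ a {s t} → s ⊑ t → inj₁ a ∷ s ⊑ t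
  ins  : ∀ x {s t} → s ⊑ t → s ⊑ inj₂ x ∷ t

module _ {M N : ℕ} where

  private
    Word : Set
    Word = List (Letter M N)

  infix 4 _∈⟦_,_⟧

  _∈⟦_,_⟧ : Word → Word → Word → Set
  v ∈⟦ u , w ⟧ = u ⊑ v × v ⊑ w

  ⊑-refl : (s : Word) → s ⊑ s
  ⊑-refl []      = []
  ⊑-refl (l ∷ s) = keep l (⊑-refl s)

  ⊑-trans : {s t r : Word} → s ⊑ t → t ⊑ r → s ⊑ r
  ⊑-trans (del a α)  β          = del a (⊑-trans α β)
  ⊑-trans α          (ins x β)  = ins x (⊑-trans α β)
  ⊑-trans []         []         = []
  ⊑-trans (keep l α) (keep _ β) = keep l (⊑-trans α β)
  ⊑-trans (keep _ α) (del a β)  = del a (⊑-trans α β)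
  ⊑-trans (ins x α)  (keep _ β) = ins x (⊑-trans α β)

  ⊑-++ : {p p' q q' : Word} → p ⊑ p' → q ⊑ q' → p ++ q ⊑ p' ++ q'
  ⊑-++ []         β = β
  ⊑-++ (keep l α) β = keep l (⊑-++ α β)
  ⊑-++ (del a α)  β = del a (⊑-++ α β)
  ⊑-++ (ins x α)  β = ins x (⊑-++ α β)

  ⊑⇒lowers-⊇ : {s t : Word} → s ⊑ t → lowers t ⊆ lowers s
  ⊑⇒lowers-⊇ []                = []
  ⊑⇒lowers-⊇ (keep (inj₁ a) α) = refl ∷ ⊑⇒lowers-⊇ α
  ⊑⇒lowers-⊇ (keep (inj₂ x) α) = ⊑⇒lowers-⊇ α
  ⊑⇒lowers-⊇ (del a α)         = a ∷ʳ ⊑⇒lowers-⊇ α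
  ⊑⇒lowers-⊇ (ins x α)         = ⊑⇒lowers-⊇ α

  ⊑⇒uppers-⊆ : {s t : Word} → s ⊑ t → uppers s ⊆ uppers t
  ⊑⇒uppers-⊆ []                = []
  ⊑⇒uppers-⊆ (keep (inj₁ a) α) = ⊑⇒uppers-⊆ α
  ⊑⇒uppers-⊆ (keep (inj₂ x) α) = refl ∷ ⊑⇒uppers-⊆ α
  ⊑⇒uppers-⊆ (del a α)         = ⊑⇒uppers-⊆ α
  ⊑⇒uppers-⊆ (ins x α)         = x ∷ʳ ⊑⇒uppers-⊆ α

  ⊑-lower-∈ : ∀ {s t : Word} {a} → s ⊑ t → inj₁ a ∈ t → inj₁ a ∈ s
  ⊑-lower-∈ (keep l α) (here eq) = here eq
  ⊑-lower-∈ (keep l α) (there m) = there (⊑-lower-∈ α m)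
  ⊑-lower-∈ (del b α)  m         = there (⊑-lower-∈ α m)
  ⊑-lower-∈ (ins x α)  (there m) = ⊑-lower-∈ α m

  ⊑-upper-∈ : ∀ {s t : Word} {x} → s ⊑ t → inj₂ x ∈ s → inj₂ x ∈ t
  ⊑-upper-∈ (keep l α) (here eq) = here eq
  ⊑-upper-∈ (keep l α) (there m) = there (⊑-upper-∈ α m)
  ⊑-upper-∈ (del b α)  (there m) = ⊑-upper-∈ α m
  ⊑-upper-∈ (ins y α)  m         = there (⊑-upper-∈ α m)

  between-isShuffle : {u v w : Word} → v ∈⟦ u , w ⟧ → IsShuffle u → IsShuffle w → IsShuffle v
  between-isShuffle (uv , vw) su sw = sorted⇒isShuffle
    ( AllPairs-resp-⊆ (⊑⇒lowers-⊇ uv) (IsShuffle.lowers-inc su)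
    , AllPairs-resp-⊆ (⊑⇒uppers-⊆ vw) (IsShuffle.uppers-inc sw))

  ∈-between : ∀ {l} {u v w : Word} → l ∈ u → l ∈ w → v ∈⟦ u , w ⟧ → l ∈ v
  ∈-between {inj₁ a} _   l∈w (_  , vw) = ⊑-lower-∈ vw l∈w
  ∈-between {inj₂ x} l∈u _   (uv , _)  = ⊑-upper-∈ uv l∈u

  lowers-⊆⇒⊑ : ∀ {as} (v : Word) → lowers v ⊆ as → map inj₁ as ⊑ v
  lowers-⊆⇒⊑ []           []        = []
  lowers-⊆⇒⊑ []           (a ∷ʳ σ)  = del a (lowers-⊆⇒⊑ [] σ)
  lowers-⊆⇒⊑ (inj₂ x ∷ v) σ         = ins x (lowers-⊆⇒⊑ v σ)
  lowers-⊆⇒⊑ (inj₁ a ∷ v) (b ∷ʳ σ)  = del b (lowers-⊆⇒⊑ (inj₁ a ∷ v) σ)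
  lowers-⊆⇒⊑ (inj₁ a ∷ v) (refl ∷ σ) = keep (inj₁ a) (lowers-⊆⇒⊑ v σ)

  uppers-⊆⇒⊑ : ∀ {xs} (v : Word) → uppers v ⊆ xs → v ⊑ map inj₂ xs
  uppers-⊆⇒⊑ []           []         = []
  uppers-⊆⇒⊑ []           (x ∷ʳ σ)   = ins x (uppers-⊆⇒⊑ [] σ)
  uppers-⊆⇒⊑ (inj₁ a ∷ v) σ          = del a (uppers-⊆⇒⊑ v σ)
  uppers-⊆⇒⊑ (inj₂ x ∷ v) (y ∷ʳ σ)   = ins y (uppers-⊆⇒⊑ (inj₂ x ∷ v) σ)
  uppers-⊆⇒⊑ (inj₂ x ∷ v) (refl ∷ σ) = keep (inj₂ x) (uppers-⊆⇒⊑ v σ)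

  -- An alignment cannot delete or insert c, since c occurs only once on each side.
  ⊑-split : ∀ (p p' : Word) {c q q'} → c ∉ p → c ∉ q → c ∉ p' → c ∉ q' →
            p ++ c ∷ q ⊑ p' ++ c ∷ q' → p ⊑ p' × q ⊑ q'
  ⊑-split []      []        _   _   _    _    (keep _ α) = [] , α
  ⊑-split []      []        _   c∉q _    _    (del a α)  = ⊥-elim (c∉q (⊑-lower-∈ α (here refl)))
  ⊑-split []      []        _   _   _    c∉q' (ins x α)  = ⊥-elim (c∉q' (⊑-upper-∈ α (here refl)))
  ⊑-split []      (_ ∷ p')  _   _   c∉p' _    (keep _ α) = ⊥-elim (c∉p' (here refl))
  ⊑-split []      (_ ∷ p')  _   c∉q _    _    (del a α)  = ⊥-elim (c∉q (⊑-lower-∈ α (∈-insert (_ ∷ p'))))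
  ⊑-split []      (_ ∷ p')  c∉p c∉q c∉p' c∉q' (ins x α)  =
    Product.map₁ (ins x) (⊑-split [] p' c∉p c∉q (c∉p' ∘ there) c∉q' α)
  ⊑-split (_ ∷ p) []        c∉p _   _    _    (keep _ α) = ⊥-elim (c∉p (here refl))
  ⊑-split (_ ∷ p) []        c∉p c∉q c∉p' c∉q' (del a α)  =
    Product.map₁ (del a) (⊑-split p [] (c∉p ∘ there) c∉q c∉p' c∉q' α)
  ⊑-split (_ ∷ p) []        _   _   _    c∉q' (ins x α)  = ⊥-elim (c∉q' (⊑-upper-∈ α (∈-insert (_ ∷ p))))
  ⊑-split (y ∷ p) (_ ∷ p')  c∉p c∉q c∉p' c∉q' (keep _ α) =
    Product.map₁ (keep y) (⊑-split p p' (c∉p ∘ there) c∉q (c∉p' ∘ there) c∉q' α)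
  ⊑-split (_ ∷ p) (y' ∷ p') c∉p c∉q c∉p' c∉q' (del a α)  =
    Product.map₁ (del a) (⊑-split p (y' ∷ p') (c∉p ∘ there) c∉q c∉p' c∉q' α)
  ⊑-split (y ∷ p) (_ ∷ p')  c∉p c∉q c∉p' c∉q' (ins x α)  =
    Product.map₁ (ins x) (⊑-split (y ∷ p) p' c∉p c∉q (c∉p' ∘ there) c∉q' α)

  ⊑-split-at : ∀ {c} {v v' : Word} → c ∈ v → c ∈ v' → Unique v → Unique v' → v ⊑ v' →
               before c v ⊑ before c v' × after c v ⊑ after c v'
  ⊑-split-at {c} {v} {v'} c∈v c∈v' uv uv' α =
    ⊑-split (before c v) (before c v') (before-∉ c v) (after-∉ v uv) (before-∉ c v') (after-∉ v' uv')
            (subst₂ _⊑_ (∈⇒≡before++after c∈v) (∈⇒≡before++after c∈v') α)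

infix 4 _⋖ʷ_

data _⋖ʷ_ {M N : ℕ} : List (Letter M N) → List (Letter M N) → Set where
  delete : ∀ p s a → p ++ inj₁ a ∷ s ⋖ʷ p ++ s
  insert : ∀ p s x → p ++ s ⋖ʷ p ++ inj₂ x ∷ s

module _ {M N : ℕ} where

  private
    Word : Set
    Word = List (Letter M N)

  ⋖⇒⋖ʷ : {v v' : W M N} → v ⋖ v' → word v ⋖ʷ word v'
  ⋖⇒⋖ʷ (delete p s a refl refl) = delete p s a
  ⋖⇒⋖ʷ (insert p s x refl refl) = insert p s x

  ⋖ʷ⇒⋖ : {v v' : W M N} → word v ⋖ʷ word v' → v ⋖ v'
  ⋖ʷ⇒⋖ c = lift c refl refl
    where
    lift : ∀ {s t} {v v' : W M N} → s ⋖ʷ t → word v ≡ s → word v' ≡ t → v ⋖ v'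
    lift (delete p s a) = delete p s a
    lift (insert p s x) = insert p s x

  ⋖ʷ⇒⊑ : {s t : Word} → s ⋖ʷ t → s ⊑ t
  ⋖ʷ⇒⊑ (delete p s a) = ⊑-++ (⊑-refl p) (del a (⊑-refl s))
  ⋖ʷ⇒⊑ (insert p s x) = ⊑-++ (⊑-refl p) (ins x (⊑-refl s))

  ⋖ʷ*⇒⊑ : {s t : Word} → Star _⋖ʷ_ s t → s ⊑ t
  ⋖ʷ*⇒⊑ ε        = ⊑-refl _
  ⋖ʷ*⇒⊑ (c ◅ cs) = ⊑-trans (⋖ʷ⇒⊑ c) (⋖ʷ*⇒⊑ cs)

  ⊑⇒⋖ʷ* : {s t : Word} → s ⊑ t → Star _⋖ʷ_ s t
  ⊑⇒⋖ʷ* []                  = ε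
  ⊑⇒⋖ʷ* (keep l α)          = gmap (l ∷_) (λ { (delete p s a) → delete (l ∷ p) s a
                                             ; (insert p s x) → insert (l ∷ p) s x }) (⊑⇒⋖ʷ* α)
  ⊑⇒⋖ʷ* (del a {s} α)       = delete [] s a ◅ ⊑⇒⋖ʷ* α
  ⊑⇒⋖ʷ* (ins x {t = t} α)   = ⊑⇒⋖ʷ* α ◅◅ (insert [] t x ◅ ε)

  length-lowers-delete : ∀ (p : Word) {s a} →
                         length (lowers (p ++ inj₁ a ∷ s)) ≡ suc (length (lowers (p ++ s)))
  length-lowers-delete []           = refl
  length-lowers-delete (inj₁ _ ∷ p) = cong suc (length-lowers-delete p)
  length-lowers-delete (inj₂ _ ∷ p) = length-lowers-delete p

  length-uppers-insert : ∀ (p : Word) {s x} →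
                         length (uppers (p ++ inj₂ x ∷ s)) ≡ suc (length (uppers (p ++ s)))
  length-uppers-insert []           = refl
  length-uppers-insert (inj₁ _ ∷ p) = length-uppers-insert p
  length-uppers-insert (inj₂ _ ∷ p) = cong suc (length-uppers-insert p)

  ⋖ʷ-⊒-irrefl : {s t : Word} → s ⋖ʷ t → ¬ (t ⊑ s)
  ⋖ʷ-⊒-irrefl (delete p s a) α =
    Natₚ.n≮n _ (subst (_≤ _) (length-lowers-delete p) (length-mono-≤ (⊑⇒lowers-⊇ α)))
  ⋖ʷ-⊒-irrefl (insert p s x) α =
    Natₚ.n≮n _ (subst (_≤ _) (length-uppers-insert p) (length-mono-≤ (⊑⇒uppers-⊆ α)))

  ≤W⇒⊑ : {v v' : W M N} → v ≤W v' → word v ⊑ word v'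
  ≤W⇒⊑ ε        = ⊑-refl _
  ≤W⇒⊑ (c ◅ cs) = ⊑-trans (⋖ʷ⇒⊑ (⋖⇒⋖ʷ c)) (≤W⇒⊑ cs)

  ≤W-≈⇒≡ : {v v' : W M N} → v ≤W v' → v ≈W v' → v ≡ v'
  ≤W-≈⇒≡ ε        _   = refl
  ≤W-≈⇒≡ (c ◅ cs) v≈v' = ⊥-elim (⋖ʷ-⊒-irrefl (⋖⇒⋖ʷ c) (subst (_ ⊑_) (sym v≈v') (≤W⇒⊑ cs)))

  module _ {X Y : W M N} where

    private
      path : (v : W M N) {t : Word} → word X ⊑ word v → word v ⋖ʷ t → Star _⋖ʷ_ t (word Y) → v ≤W Y
      path v         Xv c ε        = ⋖ʷ⇒⋖ c ◅ ε
      path v {t = t} Xv c (c' ◅ cs) = ⋖ʷ⇒⋖ c ◅ path (t , st) Xt c' cs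
        where
        Xt : word X ⊑ t
        Xt = ⊑-trans Xv (⋖ʷ⇒⊑ c)
        st : IsShuffle t
        st = between-isShuffle (Xt , ⋖ʷ*⇒⊑ (c' ◅ cs)) (proj₂ X) (proj₂ Y)

      start : ∀ {s t} → Star _⋖ʷ_ s t → word X ≡ s → word Y ≡ t → (X ≈W Y → X ≡ Y) → X ≤W Y
      start ε        refl Y≈X X≡Y = subst (X ≤W_) (X≡Y (sym Y≈X)) ε
      start (c ◅ cs) refl refl _  = path X (⊑-refl _) c cs

    -- An empty chain needs X ≡ Y, which equal words do not give: the shuffle proofs may differ.
    ⊑⇒≤W : word X ⊑ word Y → (X ≈W Y → X ≡ Y) → X ≤W Y
    ⊑⇒≤W α = start (⊑⇒⋖ʷ* α) refl refl

-- By ≤W-≈⇒≡ a monotone map into W must send equal words to identical elements; making the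
-- shuffle proof irrelevant to pick guarantees this.
module _ {M N : ℕ} (pick : (v : List (Letter M N)) → .(IsShuffle v) → W M N)
         (word-pick : ∀ v .(s : IsShuffle v) → word (pick v s) ≡ v) where

  ⊑⇒≤W-canonical : ∀ {v v'} .{s : IsShuffle v} .{s' : IsShuffle v'} → v ⊑ v' → pick v s ≤W pick v' s'
  ⊑⇒≤W-canonical {v} {v'} {s} {s'} α =
    ⊑⇒≤W (subst₂ _⊑_ (sym (word-pick v s)) (sym (word-pick v' s')) α)
         (λ e → pick-cong (trans (sym (word-pick v s)) (trans e (word-pick v' s'))))
    where
    pick-cong : v ≡ v' → pick v s ≡ pick v' s'
    pick-cong refl = refl

module Block {M N : ℕ} (as : List (Fin M)) (xs : List (Fin N)) where

  private
    Word Word′ : Set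
    Word  = List (Letter M N)
    Word′ = List (Letter (length as) (length xs))

  InBlock : Letter M N → Set
  InBlock = [ _∈ as , _∈ xs ]′

  compressLetter : Letter M N → Maybe (Letter (length as) (length xs))
  compressLetter = [ Maybe.map inj₁ ∘ position Finₚ._≟_ as , Maybe.map inj₂ ∘ position Finₚ._≟_ xs ]′

  expandLetter : Letter (length as) (length xs) → Letter M N
  expandLetter = Sum.map (lookup as) (lookup xs)

  compress : Word → Word′
  compress = mapMaybe compressLetter

  expand : Word′ → Word
  expand = map expandLetter

  between⇒inBlock : ∀ {v} → v ∈⟦ map inj₁ as , map inj₂ xs ⟧ → All InBlock v
  between⇒inBlock {v} (Av , vX) = inBlock v
    (Any-resp-⊆ (subst (lowers v ⊆_) (lowers-map-inj₁ as) (⊑⇒lowers-⊇ Av)))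
    (Any-resp-⊆ (subst (uppers v ⊆_) (uppers-map-inj₂ xs) (⊑⇒uppers-⊆ vX)))
    where
    inBlock : ∀ v → (∀ {a} → a ∈ lowers v → a ∈ as) → (∀ {x} → x ∈ uppers v → x ∈ xs) → All InBlock v
    inBlock []           _  _  = []
    inBlock (inj₁ a ∷ v) lo up = lo (here refl) ∷ inBlock v (lo ∘ there) up
    inBlock (inj₂ x ∷ v) lo up = up (here refl) ∷ inBlock v lo (up ∘ there)

  ∉⇒¬inBlock : ∀ {l} → l ∉ map inj₁ as → l ∉ map inj₂ xs → ¬ InBlock l
  ∉⇒¬inBlock {inj₁ a} l∉A _ a∈ = l∉A (∈-map⁺ inj₁ a∈)
  ∉⇒¬inBlock {inj₂ x} _ l∉X x∈ = l∉X (∈-map⁺ inj₂ x∈)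

  expand-inBlock : ∀ y → All InBlock (expand y)
  expand-inBlock y = Allₚ.map⁺ (All.universal (λ { (inj₁ k) → ∈-lookup k ; (inj₂ k) → ∈-lookup k }) y)

  ¬inBlock⇒∉-expand : ∀ {c} → ¬ InBlock c → ∀ y → c ∉ expand y
  ¬inBlock⇒∉-expand ¬c y c∈ = ¬c (All.lookup (expand-inBlock y) c∈)

  expand-compress : ∀ {v} → All InBlock v → expand (compress v) ≡ v
  expand-compress = map-mapMaybe-inverse ∘ All.map section
    where
    section : ∀ {l} → InBlock l → Maybe.map expandLetter (compressLetter l) ≡ just l
    section {inj₁ a} a∈ with lookup-position Finₚ._≟_ a∈
    ... | k , eq , refl rewrite eq = refl
    section {inj₂ x} x∈ with lookup-position Finₚ._≟_ x∈
    ... | k , eq , refl rewrite eq = refl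

  compress-mono : ∀ {v v'} → v ⊑ v' → compress v ⊑ compress v'
  compress-mono [] = []
  compress-mono (keep l α) with compressLetter l
  ... | nothing = compress-mono α
  ... | just l′ = keep l′ (compress-mono α)
  compress-mono (del a α) with position Finₚ._≟_ as a
  ... | nothing = compress-mono α
  ... | just k  = del k (compress-mono α)
  compress-mono (ins x α) with position Finₚ._≟_ xs x
  ... | nothing = compress-mono α
  ... | just k  = ins k (compress-mono α)

  expand-mono : ∀ {y y'} → y ⊑ y' → expand y ⊑ expand y'
  expand-mono []         = []
  expand-mono (keep l α) = keep (expandLetter l) (expand-mono α)
  expand-mono (del a α)  = del (lookup as a) (expand-mono α)
  expand-mono (ins x α)  = ins (lookup xs x) (expand-mono α)

  module _ (sA : IsShuffle {M} {N} (map inj₁ as)) (sX : IsShuffle {M} {N} (map inj₂ xs)) where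

    private
      sa : AllPairs _<ᶠ_ as
      sa = subst (AllPairs _<ᶠ_) (lowers-map-inj₁ as) (IsShuffle.lowers-inc sA)

      sx : AllPairs _<ᶠ_ xs
      sx = subst (AllPairs _<ᶠ_) (uppers-map-inj₂ xs) (IsShuffle.uppers-inc sX)

    compress-expand : ∀ y → compress (expand y) ≡ y
    compress-expand = mapMaybe-map-retract λ where
      (inj₁ k) → cong (Maybe.map inj₁) (position-lookup Finₚ._≟_ (AllPairs.map Finₚ.<⇒≢ sa) k)
      (inj₂ k) → cong (Maybe.map inj₂) (position-lookup Finₚ._≟_ (AllPairs.map Finₚ.<⇒≢ sx) k)

    compress-isShuffle : ∀ {v} → v ∈⟦ map inj₁ as , map inj₂ xs ⟧ → IsShuffle (compress v)
    compress-isShuffle {v} i = sorted⇒isShuffle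
      ( map-lookup-sorted⁻ Finₚ.<-isStrictTotalOrder sa
          (subst (AllPairs _<ᶠ_) (lowers-map (lookup as) (lookup xs) (compress v)) lo)
      , map-lookup-sorted⁻ Finₚ.<-isStrictTotalOrder sx
          (subst (AllPairs _<ᶠ_) (uppers-map (lookup as) (lookup xs) (compress v)) up))
      where
      sv : IsShuffle v
      sv = between-isShuffle i sA sX
      v≡ : v ≡ expand (compress v)
      v≡ = sym (expand-compress (between⇒inBlock i))
      lo : AllPairs _<ᶠ_ (lowers (expand (compress v)))
      lo = subst (AllPairs _<ᶠ_ ∘ lowers) v≡ (IsShuffle.lowers-inc sv)
      up : AllPairs _<ᶠ_ (uppers (expand (compress v)))
      up = subst (AllPairs _<ᶠ_ ∘ uppers) v≡ (IsShuffle.uppers-inc sv)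

    expand-between : ∀ {y} → IsShuffle y → expand y ∈⟦ map inj₁ as , map inj₂ xs ⟧
    expand-between {y} sy =
        lowers-⊆⇒⊑ (expand y) (subst (_⊆ as) (sym (lowers-map (lookup as) (lookup xs) y))
                                (map-lookup-⊆ Finₚ.<-isStrictTotalOrder sa (IsShuffle.lowers-inc sy)))
      , uppers-⊆⇒⊑ (expand y) (subst (_⊆ xs) (sym (uppers-map (lookup as) (lookup xs) y))
                                (map-lookup-⊆ Finₚ.<-isStrictTotalOrder sx (IsShuffle.uppers-inc sy)))

  module _ .(sA : IsShuffle {M} {N} (map inj₁ as)) .(sX : IsShuffle {M} {N} (map inj₂ xs)) where

    compressW : (v : Word) → .(v ∈⟦ map inj₁ as , map inj₂ xs ⟧) → W (length as) (length xs)
    compressW v i = mkW (compress v) (compress-isShuffle sA sX i)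

    compressW-mono : ∀ {v v'} .(i : v ∈⟦ map inj₁ as , map inj₂ xs ⟧)
                     .(i' : v' ∈⟦ map inj₁ as , map inj₂ xs ⟧) → v ⊑ v' → compressW v i ≤W compressW v' i'
    compressW-mono i i' α = ⊑⇒≤W-canonical mkW (λ _ _ → refl)
      {s = compress-isShuffle sA sX i} {s' = compress-isShuffle sA sX i'} (compress-mono α)

module _ {M N : ℕ} where

  data Blocks : List (Letter M N) → List (Letter M N) → Set where
    lastBlock : (as : List (Fin M)) (xs : List (Fin N)) → Blocks (map inj₁ as) (map inj₂ xs)
    block     : (as : List (Fin M)) (xs : List (Fin N)) (c : Letter M N) {u w : List (Letter M N)} →
                Blocks u w → Blocks (map inj₁ as ++ c ∷ u) (map inj₂ xs ++ c ∷ w)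

  private
    pushLower : ∀ a {u w} → Blocks u w → Blocks (inj₁ a ∷ u) w
    pushLower a (lastBlock as xs) = lastBlock (a ∷ as) xs
    pushLower a (block as xs c τ) = block (a ∷ as) xs c τ

    pushUpper : ∀ x {u w} → Blocks u w → Blocks u (inj₂ x ∷ w)
    pushUpper x (lastBlock as xs) = lastBlock as (x ∷ xs)
    pushUpper x (block as xs c τ) = block as (x ∷ xs) c τ

  blocks : ∀ {u w} → u ⊑ w → Blocks u w
  blocks []         = lastBlock [] []
  blocks (keep l α) = block [] [] l (blocks α)
  blocks (del a α)  = pushLower a (blocks α)
  blocks (ins x α)  = pushUpper x (blocks α)

  shape : ∀ {u w} → Blocks u w → List (ℕ × ℕ)
  shape (lastBlock as xs) = (length as , length xs) ∷ []
  shape (block as xs c τ) = (length as , length xs) ∷ shape τ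

module SplitAt {M N : ℕ} (as : List (Fin M)) (xs : List (Fin N)) (c : Letter M N)
               {u w : List (Letter M N)}
               (su : IsShuffle (map inj₁ as ++ c ∷ u)) (sw : IsShuffle (map inj₂ xs ++ c ∷ w)) where

  private
    A X : List (Letter M N)
    A = map inj₁ as
    X = map inj₂ xs

    c∉A : c ∉ A
    c∉A = ∉-++-∷ˡ A (IsShuffle.distinct su)

    c∉X : c ∉ X
    c∉X = ∉-++-∷ˡ X (IsShuffle.distinct sw)

  sA : IsShuffle A
  sA = prefix-isShuffle A su

  sX : IsShuffle X
  sX = prefix-isShuffle X sw

  su′ : IsShuffle u
  su′ = suffix-isShuffle (c ∷ []) (suffix-isShuffle A su)

  sw′ : IsShuffle w
  sw′ = suffix-isShuffle (c ∷ []) (suffix-isShuffle X sw)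

  c∉expand : ∀ y → c ∉ Block.expand as xs y
  c∉expand = Block.¬inBlock⇒∉-expand as xs (Block.∉⇒¬inBlock as xs c∉A c∉X)

  c∈ : ∀ {v} → v ∈⟦ A ++ c ∷ u , X ++ c ∷ w ⟧ → c ∈ v
  c∈ = ∈-between (∈-insert A) (∈-insert X)

  private
    unique : ∀ {v} → v ∈⟦ A ++ c ∷ u , X ++ c ∷ w ⟧ → Unique v
    unique i = IsShuffle.distinct (between-isShuffle i su sw)

  split-mono : ∀ {v v'} → v ∈⟦ A ++ c ∷ u , X ++ c ∷ w ⟧ → v' ∈⟦ A ++ c ∷ u , X ++ c ∷ w ⟧ → v ⊑ v' →
               before c v ⊑ before c v' × after c v ⊑ after c v'
  split-mono i i' = ⊑-split-at (c∈ i) (c∈ i') (unique i) (unique i')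

  private
    module _ {v} (i : v ∈⟦ A ++ c ∷ u , X ++ c ∷ w ⟧) where
      uw : A ++ c ∷ u ⊑ X ++ c ∷ w
      uw = ⊑-trans (proj₁ i) (proj₂ i)

      from-bottom : before c (A ++ c ∷ u) ⊑ before c v × after c (A ++ c ∷ u) ⊑ after c v
      from-bottom = split-mono (⊑-refl _ , uw) i (proj₁ i)

      to-top : before c v ⊑ before c (X ++ c ∷ w) × after c v ⊑ after c (X ++ c ∷ w)
      to-top = split-mono i (uw , ⊑-refl _) (proj₂ i)

  prefix-between : ∀ {v} → v ∈⟦ A ++ c ∷ u , X ++ c ∷ w ⟧ → before c v ∈⟦ A , X ⟧
  prefix-between i = subst (_⊑ _) (before-++-∷ c A c∉A) (proj₁ (from-bottom i))
                   , subst (_ ⊑_) (before-++-∷ c X c∉X) (proj₁ (to-top i))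

  suffix-between : ∀ {v} → v ∈⟦ A ++ c ∷ u , X ++ c ∷ w ⟧ → after c v ∈⟦ u , w ⟧
  suffix-between i = subst (_⊑ _) (after-++-∷ c A c∉A) (proj₂ (from-bottom i))
                   , subst (_ ⊑_) (after-++-∷ c X c∉X) (proj₂ (to-top i))

≈P-refl : ∀ {ds} (x : Prod ds) → x ≈P x
≈P-refl {[]}    _        = tt
≈P-refl {_ ∷ _} (_ , xs) = refl , ≈P-refl xs

≈P-trans : ∀ {ds} {x y z : Prod ds} → x ≈P y → y ≈P z → x ≈P z
≈P-trans {[]}    _          _          = tt
≈P-trans {_ ∷ _} (e₁ , es₁) (e₂ , es₂) = trans e₁ e₂ , ≈P-trans es₁ es₂

module _ {M N : ℕ} where

  private
    Word : Set
    Word = List (Letter M N)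

  toProd : ∀ {u w : Word} (τ : Blocks u w) → IsShuffle u → IsShuffle w →
           (v : Word) → .(v ∈⟦ u , w ⟧) → Prod (shape τ)
  toProd (lastBlock as xs) su sw v i = Block.compressW as xs su sw v i , tt
  toProd (block as xs c τ) su sw v i =
      Block.compressW as xs G.sA G.sX (before c v) (G.prefix-between i)
    , toProd τ G.su′ G.sw′ (after c v) (G.suffix-between i)
    where module G = SplitAt as xs c su sw

  fromProd : ∀ {u w : Word} (τ : Blocks u w) → Prod (shape τ) → Word
  fromProd (lastBlock as xs) (y , _)  = Block.expand as xs (word y)
  fromProd (block as xs c τ) (y , ys) = Block.expand as xs (word y) ++ c ∷ fromProd τ ys

  toProd-cong : ∀ {u w : Word} (τ : Blocks u w) (su : IsShuffle u) (sw : IsShuffle w) {v v'} → v ≡ v' →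
                .(i : v ∈⟦ u , w ⟧) .(i' : v' ∈⟦ u , w ⟧) → toProd τ su sw v i ≈P toProd τ su sw v' i'
  toProd-cong τ su sw refl i _ = ≈P-refl (toProd τ su sw _ i)

  fromProd-between : ∀ {u w : Word} (τ : Blocks u w) → IsShuffle u → IsShuffle w →
                     ∀ y → fromProd τ y ∈⟦ u , w ⟧
  fromProd-between (lastBlock as xs) su sw (y , _)  = Block.expand-between as xs su sw (proj₂ y)
  fromProd-between (block as xs c {u′} {w′} τ) su sw (y , ys) =
    ⊑-++ (proj₁ first) (keep c (proj₁ rest)) , ⊑-++ (proj₂ first) (keep c (proj₂ rest))
    where
    module G = SplitAt as xs c su sw
    first : Block.expand as xs (word y) ∈⟦ map inj₁ as , map inj₂ xs ⟧
    first = Block.expand-between as xs G.sA G.sX (proj₂ y)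
    rest : fromProd τ ys ∈⟦ u′ , w′ ⟧
    rest  = fromProd-between τ G.su′ G.sw′ ys

  fromProd-mono : ∀ {u w : Word} (τ : Blocks u w) {y y'} → y ≤P y' → fromProd τ y ⊑ fromProd τ y'
  fromProd-mono (lastBlock as xs) (y≤y' , _)   = Block.expand-mono as xs (≤W⇒⊑ y≤y')
  fromProd-mono (block as xs c τ) (y≤y' , ys≤) =
    ⊑-++ (Block.expand-mono as xs (≤W⇒⊑ y≤y')) (keep c (fromProd-mono τ ys≤))

  toProd-mono : ∀ {u w : Word} (τ : Blocks u w) (su : IsShuffle u) (sw : IsShuffle w) {v v'}
                (i : v ∈⟦ u , w ⟧) (i' : v' ∈⟦ u , w ⟧) → v ⊑ v' →
                toProd τ su sw v i ≤P toProd τ su sw v' i'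
  toProd-mono (lastBlock as xs) su sw i i' α = Block.compressW-mono as xs su sw i i' α , tt
  toProd-mono (block as xs c τ) su sw {v} {v'} i i' α =
      Block.compressW-mono as xs G.sA G.sX (G.prefix-between i) (G.prefix-between i') (proj₁ split)
    , toProd-mono τ G.su′ G.sw′ (G.suffix-between i) (G.suffix-between i') (proj₂ split)
    where
    module G = SplitAt as xs c su sw
    split : before c v ⊑ before c v' × after c v ⊑ after c v'
    split = G.split-mono i i' α

  fromProd∘toProd : ∀ {u w : Word} (τ : Blocks u w) (su : IsShuffle u) (sw : IsShuffle w) {v}
                    (i : v ∈⟦ u , w ⟧) → fromProd τ (toProd τ su sw v i) ≡ v
  fromProd∘toProd (lastBlock as xs) su sw i = Block.expand-compress as xs (Block.between⇒inBlock as xs i)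
  fromProd∘toProd (block as xs c τ) su sw {v} i = begin
    B.expand (B.compress (before c v)) ++ c ∷ fromProd τ (toProd τ G.su′ G.sw′ (after c v) _)
      ≡⟨ cong₂ (λ g r → g ++ c ∷ r) (B.expand-compress (B.between⇒inBlock (G.prefix-between i)))
                                    (fromProd∘toProd τ G.su′ G.sw′ (G.suffix-between i)) ⟩
    before c v ++ c ∷ after c v
      ≡⟨ sym (∈⇒≡before++after (G.c∈ i)) ⟩
    v ∎
    where
    module B = Block as xs
    module G = SplitAt as xs c su sw
    open ≡-Reasoning

  toProd∘fromProd : ∀ {u w : Word} (τ : Blocks u w) (su : IsShuffle u) (sw : IsShuffle w) y
                    .(i : fromProd τ y ∈⟦ u , w ⟧) → toProd τ su sw (fromProd τ y) i ≈P y
  toProd∘fromProd (lastBlock as xs) su sw (y , _) i = Block.compress-expand as xs su sw (word y) , tt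
  toProd∘fromProd (block as xs c {u′} {w′} τ) su sw (y , ys) i =
      trans (cong B.compress (before-++-∷ c (B.expand (word y)) c∉y))
            (B.compress-expand G.sA G.sX (word y))
    , ≈P-trans (toProd-cong τ G.su′ G.sw′ (after-++-∷ c (B.expand (word y)) c∉y)
                            (G.suffix-between i) rest)
               (toProd∘fromProd τ G.su′ G.sw′ ys rest)
    where
    module B = Block as xs
    module G = SplitAt as xs c su sw
    c∉y : c ∉ B.expand (word y)
    c∉y  = G.c∉expand (word y)
    rest : fromProd τ ys ∈⟦ u′ , w′ ⟧
    rest = fromProd-between τ G.su′ G.sw′ ys

module IntervalIso {M N : ℕ} (u w : W M N) (u≤w : u ≤W w) where

  private
    Word : Set
    Word = List (Letter M N)
    _≟ʷ_ : DecidableEquality Word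
    _≟ʷ_ = ≡-dec _≟ˡ_

    τ : Blocks (word u) (word w)
    τ = blocks (≤W⇒⊑ u≤w)

    su : IsShuffle (word u)
    su = proj₂ u

    sw : IsShuffle (word w)
    sw = proj₂ w

  -- Nothing but u itself lies above u with the word of u (≤W-≈⇒≡), and likewise for w.
  represent : (v : Word) → .(IsShuffle v) → W M N
  represent v s with v ≟ʷ word u | v ≟ʷ word w
  ... | yes _ | _     = u
  ... | no _  | yes _ = w
  ... | no _  | no _  = mkW v s

  word-represent : ∀ v .(s : IsShuffle v) → word (represent v s) ≡ v
  word-represent v s with v ≟ʷ word u | v ≟ʷ word w
  ... | yes v≡u | _       = sym v≡u
  ... | no _    | yes v≡w = sym v≡w
  ... | no _    | no _    = refl

  represent-bottom : represent (word u) su ≡ u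
  represent-bottom with word u ≟ʷ word u
  ... | yes _   = refl
  ... | no  u≢u = ⊥-elim (u≢u refl)

  represent-top : represent (word w) sw ≡ w
  represent-top with word w ≟ʷ word u | word w ≟ʷ word w
  ... | yes w≡u | _       = ≤W-≈⇒≡ u≤w (sym w≡u)
  ... | no _    | yes _   = refl
  ... | no _    | no  w≢w = ⊥-elim (w≢w refl)

  private
    represent-mono : ∀ {v v'} .{s : IsShuffle v} .{s' : IsShuffle v'} → v ⊑ v' →
                     represent v s ≤W represent v' s'
    represent-mono = ⊑⇒≤W-canonical represent word-represent

    from-between : ∀ y → fromProd τ y ∈⟦ word u , word w ⟧
    from-between = fromProd-between τ su sw

    from-isShuffle : ∀ y → IsShuffle (fromProd τ y)
    from-isShuffle y = between-isShuffle (from-between y) su sw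

  to : Interval u w → Prod (shape τ)
  to (v , u≤v , v≤w) = toProd τ su sw (word v) (≤W⇒⊑ u≤v , ≤W⇒⊑ v≤w)

  from : Prod (shape τ) → Interval u w
  from y = represent v sv
         , subst (_≤W represent v sv) represent-bottom (represent-mono {s = su} (proj₁ (from-between y)))
         , subst (represent v sv ≤W_) represent-top (represent-mono {s' = sw} (proj₂ (from-between y)))
    where
    v : Word
    v  = fromProd τ y
    sv : IsShuffle v
    sv = from-isShuffle y

  to-mono : ∀ {x y} → x ≤I y → to x ≤P to y
  to-mono {_ , u≤v , v≤w} {_ , u≤v' , v'≤w} v≤v' =
    toProd-mono τ su sw (≤W⇒⊑ u≤v , ≤W⇒⊑ v≤w) (≤W⇒⊑ u≤v' , ≤W⇒⊑ v'≤w) (≤W⇒⊑ v≤v')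

  from-mono : ∀ {x y} → x ≤P y → from x ≤I from y
  from-mono x≤y = represent-mono (fromProd-mono τ x≤y)

  from∘to : ∀ x → from (to x) ≈I x
  from∘to x@(v , u≤v , v≤w) = trans (word-represent _ (from-isShuffle (to x)))
                                    (fromProd∘toProd τ su sw (≤W⇒⊑ u≤v , ≤W⇒⊑ v≤w))

  to∘from : ∀ y → to (from y) ≈P y
  to∘from y = ≈P-trans (toProd-cong τ su sw (word-represent _ (from-isShuffle y)) _ (from-between y))
                       (toProd∘fromProd τ su sw y (from-between y))

  iso : OrderIso (_≈I_ {u = u} {w = w}) (_≤I_ {u = u} {w = w}) (_≈P_ {shape τ}) (_≤P_ {shape τ})
  iso = record
    { to        = to
    ; from      = from
    ; to-mono   = λ {x} {y} → to-mono {x} {y}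
    ; from-mono = from-mono
    ; from∘to   = from∘to
    ; to∘from   = to∘from
    }

lemma2p2 : (M N : ℕ) (u w : W M N) → u ≤W w →
           Σ (List (ℕ × ℕ)) λ ds →
             OrderIso (_≈I_ {u = u} {w = w}) (_≤I_ {u = u} {w = w})
                      (_≈P_ {ds}) (_≤P_ {ds})
lemma2p2 M N u w u≤w = shape (blocks (≤W⇒⊑ u≤w)) , IntervalIso.iso u w u≤w
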